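{- Let $q=2^m$, where $m$ is a positive integer, and let $a,b\in\mathbb{F}_q^*$. Then $$f_2(X)=aX^{1+q}+bX^{1+q^2}+X^{2q^2+2q}$$ is a permutation polynomial over $\mathbb{F}_{q^3}$ if and only if $b=a$.
   Context: A polynomial $f\in\mathbb{F}_{Q}[X]$ is a permutation polynomial over $\mathbb{F}_Q$ if $c\mapsto f(c)$ is a bijection of $\mathbb{F}_Q$. -}

module Defs where

open import Level using (Level; _⊔_)
open import Data.Nat using (ℕ; zero; suc)
open import Data.Fin using (Fin)
open import Data.Product using (Σ; _×_)
open import Relation.Nullary using (¬_)
open import Algebra.Bundles using (CommutativeRing)
open import Function.Bundles using (Bijection)
open import Function.Definitions using (Bijective)
import Relation.Binary.PropositionalEquality as P

record Field (c ℓ : Level) : Set (Level.suc (c ⊔ ℓ)) where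
  field
    commRing : CommutativeRing c ℓ
  open CommutativeRing commRing public
  field
    0≉1     : ¬ (0# ≈ 1#)
    inverse : ∀ x → ¬ (x ≈ 0#) → Σ Carrier (λ y → (x * y) ≈ 1#)

module _ {c ℓ} (F : Field c ℓ) where
  open Field F

  pow : Carrier → ℕ → Carrier
  pow x zero    = 1#
  pow x (suc n) = x * pow x n

  HasCard : ℕ → Set (c ⊔ ℓ)
  HasCard n = Bijection setoid (P.setoid (Fin n))

  IsPermutation : (Carrier → Carrier) → Set (c ⊔ ℓ)
  IsPermutation f = Bijective _≈_ _≈_ f

  -- x lies in the subfield with q elements, i.e. x^q = x
  InSubfield : ℕ → Carrier → Set ℓ
  InSubfield q x = pow x q ≈ x

{-# OPTIONS --safe #-}
-- Write σ x = x ^ q.  As F has q³ elements, σ is additive and multiplicative with σ³ = id and fixes a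
-- and b, and F has characteristic 2.  If b = a, then f = L ∘ ν with ν x = x σ(x) and
-- L y = a y + a σ²(y) + σ(y)²; both are injective (L is additive with trivial kernel), and an injective
-- self-map of a finite set is bijective.  If b ≠ a, a square root r of a + b is a nonzero root of f.
module Submission where

open import Defs
open import Level using (Level)
open import Data.Nat using (ℕ; zero; suc)
import Data.Nat as N
import Data.Nat.Properties as NP
open import Data.Nat.Divisibility using (_∣_; divides; ∣-trans; m∣m*n)
open import Data.Fin using (Fin; punchIn; punchOut)
import Data.Fin.Properties as FP
open import Data.Fin.Permutation using (Permutation; permutation)
open import Data.Product using (_,_; proj₁; proj₂; ∃)
open import Data.Empty using (⊥-elim)
open import Function.Base using (_∘_)
open import Data.Vec.Functional using (Vector; replicate)
open import Relation.Nullary using (¬_; yes; no)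
open import Relation.Binary.Definitions using (Decidable)
open import Relation.Binary.PropositionalEquality as ≡ using (_≡_)
open import Function.Bundles using (_⇔_; Bijection; Inverse; mk⇔)
open import Function.Definitions using (Congruent; Injective; Surjective; StrictlySurjective)
open import Function.Properties.Bijection using (Bijection⇒Inverse)
open import Function.Consequences using (strictlySurjective⇒surjective)

Fin-injective⇒strictlySurjective : ∀ {n} (φ : Fin n → Fin n) → Injective _≡_ _≡_ φ → StrictlySurjective _≡_ φ
Fin-injective⇒strictlySurjective {zero}  φ φ-injective ()
Fin-injective⇒strictlySurjective {suc n} φ φ-injective k with FP.any? (λ i → φ i FP.≟ k)
... | yes hit = hit
... | no miss = ⊥-elim (NP.<-irrefl ≡.refl (FP.injective⇒≤ ψ-injective))
  where
  k∉φ : ∀ i → k ≡.≢ φ i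
  k∉φ i k≡φi = miss (i , ≡.sym k≡φi)
  ψ-injective : Injective _≡_ _≡_ (λ i → punchOut (k∉φ i))
  ψ-injective eq = φ-injective (FP.punchOut-injective (k∉φ _) (k∉φ _) eq)

module _ {c ℓ} (F : Field c ℓ) where
  open Field F
  open import Algebra.Solver.Ring.NaturalCoefficients.Default commutativeSemiring using (solve; _:+_; _:*_; _:=_)
  open import Algebra.Properties.CommutativeSemiring.Exp commutativeSemiring
  open import Algebra.Properties.CommutativeMonoid.Sum *-commutativeMonoid
    using (sum-permute; sum-cong-≋; ∑-distrib-+; sum-replicate) renaming (sum to prod)
  open import Algebra.Properties.Ring ring using (-1*x≈-x; -‿involutive)
  open import Relation.Binary.Reasoning.Setoid setoid

  pow≡^ : ∀ x n → pow F x n ≡ x ^ n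
  pow≡^ x zero    = ≡.refl
  pow≡^ x (suc n) = ≡.cong (x *_) (pow≡^ x n)

  1^n≈1 : ∀ n → 1# ^ n ≈ 1#
  1^n≈1 zero    = refl
  1^n≈1 (suc n) = trans (*-identityˡ _) (1^n≈1 n)

  ^-double : ∀ x n → x ^ (2 N.* n) ≈ x ^ n * x ^ n
  ^-double x n = trans (^-homo-* x n (n N.+ 0)) (*-congˡ (^-congʳ x (NP.+-identityʳ n)))

  1≉0 : ¬ 1# ≈ 0#
  1≉0 1≈0 = 0≉1 (sym 1≈0)

  x*y≈0⇒y≈0 : ∀ {x y} → ¬ x ≈ 0# → x * y ≈ 0# → y ≈ 0#
  x*y≈0⇒y≈0 {x} {y} x≉0 xy≈0 with inverse x x≉0
  ... | x⁻¹ , xx⁻¹≈1 = begin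
    y               ≈⟨ *-identityˡ y ⟨
    1# * y          ≈⟨ *-congʳ (trans (*-comm x⁻¹ x) xx⁻¹≈1) ⟨
    (x⁻¹ * x) * y   ≈⟨ *-assoc x⁻¹ x y ⟩
    x⁻¹ * (x * y)   ≈⟨ *-congˡ xy≈0 ⟩
    x⁻¹ * 0#        ≈⟨ zeroʳ x⁻¹ ⟩
    0#              ∎

  x*y≉0 : ∀ {x y} → ¬ x ≈ 0# → ¬ y ≈ 0# → ¬ x * y ≈ 0#
  x*y≉0 x≉0 y≉0 xy≈0 = y≉0 (x*y≈0⇒y≈0 x≉0 xy≈0)

  x*y≈y⇒x≈1 : ∀ {x y} → ¬ y ≈ 0# → x * y ≈ y → x ≈ 1#
  x*y≈y⇒x≈1 {x} {y} y≉0 xy≈y with inverse y y≉0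
  ... | y⁻¹ , yy⁻¹≈1 = begin
    x               ≈⟨ *-identityʳ x ⟨
    x * 1#          ≈⟨ *-congˡ yy⁻¹≈1 ⟨
    x * (y * y⁻¹)   ≈⟨ *-assoc x y y⁻¹ ⟨
    (x * y) * y⁻¹   ≈⟨ *-congʳ xy≈y ⟩
    y * y⁻¹         ≈⟨ yy⁻¹≈1 ⟩
    1#              ∎

  prod-≉0 : ∀ {n} (v : Vector Carrier n) → (∀ i → ¬ v i ≈ 0#) → ¬ prod v ≈ 0#
  prod-≉0 {zero}  v v≉0 = 1≉0
  prod-≉0 {suc n} v v≉0 = x*y≉0 (v≉0 Fin.zero) (prod-≉0 (λ i → v (Fin.suc i)) (λ i → v≉0 (Fin.suc i)))

  module _ (_≟_ : Decidable _≈_) where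

    x*x≈0⇒x≈0 : ∀ {x} → x * x ≈ 0# → x ≈ 0#
    x*x≈0⇒x≈0 {x} xx≈0 with x ≟ 0#
    ... | yes x≈0 = x≈0
    ... | no  x≉0 = x*y≈0⇒y≈0 x≉0 xx≈0

  injective-resp-≈ : ∀ {f g : Carrier → Carrier} → (∀ x → f x ≈ g x) → Injective _≈_ _≈_ f → Injective _≈_ _≈_ g
  injective-resp-≈ f≈g f-injective gx≈gy = f-injective (trans (f≈g _) (trans gx≈gy (sym (f≈g _))))

  module FiniteField {n : ℕ} (card : HasCard F n) where
    open Bijection card using (to; injective)
    open Inverse (Bijection⇒Inverse card) using (from; to-cong; strictlyInverseˡ; strictlyInverseʳ)

    _≟_ : Decidable _≈_
    x ≟ y with to x FP.≟ to y
    ... | yes tx≡ty = yes (injective tx≡ty)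
    ... | no  tx≢ty = no (λ x≈y → tx≢ty (to-cong x≈y))

    injective⇒surjective : ∀ {g} → Congruent _≈_ _≈_ g → Injective _≈_ _≈_ g → Surjective _≈_ _≈_ g
    injective⇒surjective {g} g-cong g-injective = strictlySurjective⇒surjective trans g-cong g-onto
      where
      φ : Fin n → Fin n
      φ i = to (g (from i))
      φ-injective : Injective _≡_ _≡_ φ
      φ-injective {i} {j} eq = ≡.trans (≡.sym (strictlyInverseˡ i))
        (≡.trans (to-cong (g-injective (injective eq))) (strictlyInverseˡ j))
      g-onto : StrictlySurjective _≈_ g
      g-onto y with Fin-injective⇒strictlySurjective φ φ-injective (to y)
      ... | i , φi≡y = from i , injective φi≡y

  -- Multiplication by a nonzero a permutes the nonzero elements, so their product P satisfies a ^ N * P ≈ P.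
  module Units {N : ℕ} (card : HasCard F (suc N)) where
    open Bijection card using (to; injective)
    open Inverse (Bijection⇒Inverse card) using (from; to-cong; strictlyInverseˡ; strictlyInverseʳ)

    unit : Fin N → Carrier
    unit j = from (punchIn (to 0#) j)

    unit≉0 : ∀ j → ¬ unit j ≈ 0#
    unit≉0 j unit≈0 = FP.punchInᵢ≢i (to 0#) j (≡.trans (≡.sym (strictlyInverseˡ _)) (to-cong unit≈0))

    unitIndex : ∀ {x} → ¬ x ≈ 0# → Fin N
    unitIndex x≉0 = punchOut {i = to 0#} (λ eq → x≉0 (injective (≡.sym eq)))

    unit-unitIndex : ∀ {x} (x≉0 : ¬ x ≈ 0#) → unit (unitIndex x≉0) ≈ x
    unit-unitIndex {x} x≉0 = trans (reflexive (≡.cong from (FP.punchIn-punchOut _))) (strictlyInverseʳ x)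

    unitIndex-unit : ∀ {x} (x≉0 : ¬ x ≈ 0#) {j} → x ≈ unit j → unitIndex x≉0 ≡ j
    unitIndex-unit x≉0 {j} x≈unit = ≡.trans
      (FP.punchOut-cong (to 0#) (≡.trans (to-cong x≈unit) (strictlyInverseˡ _)))
      (FP.punchOut-punchIn (to 0#))

    a*unit≉0 : ∀ {a} → ¬ a ≈ 0# → ∀ j → ¬ a * unit j ≈ 0#
    a*unit≉0 a≉0 j = x*y≉0 a≉0 (unit≉0 j)

    scale : ∀ {a} → ¬ a ≈ 0# → Fin N → Fin N
    scale a≉0 j = unitIndex (a*unit≉0 a≉0 j)

    unit-scale : ∀ {a} (a≉0 : ¬ a ≈ 0#) j → unit (scale a≉0 j) ≈ a * unit j
    unit-scale a≉0 j = unit-unitIndex (a*unit≉0 a≉0 j)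

    scale-inverse : ∀ {a b} (a≉0 : ¬ a ≈ 0#) (b≉0 : ¬ b ≈ 0#) → a * b ≈ 1# → ∀ j → scale a≉0 (scale b≉0 j) ≡ j
    scale-inverse {a} {b} a≉0 b≉0 ab≈1 j = unitIndex-unit (a*unit≉0 a≉0 (scale b≉0 j)) (begin
      a * unit (scale b≉0 j)  ≈⟨ *-congˡ (unit-scale b≉0 j) ⟩
      a * (b * unit j)        ≈⟨ *-assoc a b (unit j) ⟨
      (a * b) * unit j        ≈⟨ *-congʳ ab≈1 ⟩
      1# * unit j             ≈⟨ *-identityˡ (unit j) ⟩
      unit j                  ∎)

    scaling : ∀ {a} → ¬ a ≈ 0# → Permutation N N
    scaling {a} a≉0 = permutation (scale a≉0) (scale a⁻¹≉0) (scale-inverse a≉0 a⁻¹≉0 aa⁻¹≈1)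
                                  (scale-inverse a⁻¹≉0 a≉0 (trans (*-comm a⁻¹ a) aa⁻¹≈1))
      where
      a⁻¹ : Carrier
      a⁻¹ = proj₁ (inverse a a≉0)
      aa⁻¹≈1 : a * a⁻¹ ≈ 1#
      aa⁻¹≈1 = proj₂ (inverse a a≉0)
      a⁻¹≉0 : ¬ a⁻¹ ≈ 0#
      a⁻¹≉0 a⁻¹≈0 = 1≉0 (trans (sym aa⁻¹≈1) (trans (*-congˡ a⁻¹≈0) (zeroʳ a)))

    x^N≈1 : ∀ {x} → ¬ x ≈ 0# → x ^ N ≈ 1#
    x^N≈1 {x} x≉0 = x*y≈y⇒x≈1 (prod-≉0 unit unit≉0) (sym (begin
      prod unit                         ≈⟨ sum-permute unit (scaling x≉0) ⟩
      prod (λ j → unit (scale x≉0 j))   ≈⟨ sum-cong-≋ (unit-scale x≉0) ⟩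
      prod (λ j → x * unit j)           ≈⟨ ∑-distrib-+ (replicate N x) unit ⟩
      prod (replicate N x) * prod unit  ≈⟨ *-congʳ (sum-replicate N) ⟩
      x ^ N * prod unit                 ∎))

  x^card≈x : ∀ {n} → HasCard F n → ∀ x → x ^ n ≈ x
  x^card≈x {zero}  card x with Bijection.to card x
  ... | ()
  x^card≈x {suc N} card x with FiniteField._≟_ card x 0#
  ... | yes x≈0 = trans (*-congʳ x≈0) (trans (zeroˡ _) (sym x≈0))
  ... | no  x≉0 = trans (*-congˡ (Units.x^N≈1 card x≉0)) (*-identityʳ x)

  even-cardinality⇒1+1≈0 : ∀ {n} → HasCard F n → 2 ∣ n → 1# + 1# ≈ 0#
  even-cardinality⇒1+1≈0 {n} card (divides k n≡k*2) = begin
    1# + 1#    ≈⟨ +-congˡ 1≈-1 ⟩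
    1# + - 1#  ≈⟨ -‿inverseʳ 1# ⟩
    0#         ∎
    where
    [-1]²≈1 : (- 1#) ^ 2 ≈ 1#
    [-1]²≈1 = trans (*-congˡ (*-identityʳ (- 1#))) (trans (-1*x≈-x (- 1#)) (-‿involutive 1#))
    1≈-1 : 1# ≈ - 1#
    1≈-1 = begin
      1#                  ≈⟨ 1^n≈1 k ⟨
      1# ^ k              ≈⟨ ^-congˡ k [-1]²≈1 ⟨
      ((- 1#) ^ 2) ^ k    ≈⟨ ^-assocʳ (- 1#) 2 k ⟩
      (- 1#) ^ (2 N.* k)  ≡⟨ ≡.cong ((- 1#) ^_) (≡.trans n≡k*2 (NP.*-comm k 2)) ⟨
      (- 1#) ^ n          ≈⟨ x^card≈x card (- 1#) ⟩
      - 1#                ∎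

  module Characteristic2 (1+1≈0 : 1# + 1# ≈ 0#) where

    x+x≈0 : ∀ x → x + x ≈ 0#
    x+x≈0 x = begin
      x + x             ≈⟨ +-cong (*-identityʳ x) (*-identityʳ x) ⟨
      x * 1# + x * 1#   ≈⟨ distribˡ x 1# 1# ⟨
      x * (1# + 1#)     ≈⟨ *-congˡ 1+1≈0 ⟩
      x * 0#            ≈⟨ zeroʳ x ⟩
      0#                ∎

    x+y≈0⇒x≈y : ∀ {x y} → x + y ≈ 0# → x ≈ y
    x+y≈0⇒x≈y {x} {y} x+y≈0 = begin
      x              ≈⟨ +-identityʳ x ⟨
      x + 0#         ≈⟨ +-congˡ (x+x≈0 y) ⟨
      x + (y + y)    ≈⟨ +-assoc x y y ⟨
      (x + y) + y    ≈⟨ +-congʳ x+y≈0 ⟩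
      0# + y         ≈⟨ +-identityˡ y ⟩
      y              ∎

    x≈y⇒x+y≈0 : ∀ {x y} → x ≈ y → x + y ≈ 0#
    x≈y⇒x+y≈0 {x} {y} x≈y = trans (+-congʳ x≈y) (x+x≈0 y)

    square-+ : ∀ x y → (x + y) * (x + y) ≈ x * x + y * y
    square-+ x y = begin
      (x + y) * (x + y)                  ≈⟨ expand x y ⟩
      (x * x + y * y) + (x * y + x * y)  ≈⟨ +-congˡ (x+x≈0 (x * y)) ⟩
      (x * x + y * y) + 0#               ≈⟨ +-identityʳ _ ⟩
      x * x + y * y                      ∎
      where
      expand : ∀ x y → (x + y) * (x + y) ≈ (x * x + y * y) + (x * y + x * y)
      expand = solve 2 (λ x y → (x :+ y) :* (x :+ y) := (x :* x :+ y :* y) :+ (x :* y :+ x :* y)) refl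

    freshmans-dream : ∀ k x y → (x + y) ^ (2 N.^ k) ≈ x ^ (2 N.^ k) + y ^ (2 N.^ k)
    freshmans-dream zero    x y = trans (*-identityʳ (x + y)) (+-cong (sym (*-identityʳ x)) (sym (*-identityʳ y)))
    freshmans-dream (suc k) x y = begin
      (x + y) ^ (2 N.* e)              ≈⟨ ^-double (x + y) e ⟩
      (x + y) ^ e * (x + y) ^ e        ≈⟨ *-cong (freshmans-dream k x y) (freshmans-dream k x y) ⟩
      (x ^ e + y ^ e) * (x ^ e + y ^ e) ≈⟨ square-+ (x ^ e) (y ^ e) ⟩
      x ^ e * x ^ e + y ^ e * y ^ e    ≈⟨ +-cong (^-double x e) (^-double y e) ⟨
      x ^ (2 N.* e) + y ^ (2 N.* e)    ∎
      where
      e : ℕ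
      e = 2 N.^ k

    module _ (_≟_ : Decidable _≈_) where

      square-injective : ∀ {x y} → x * x ≈ y * y → x ≈ y
      square-injective {x} {y} xx≈yy = x+y≈0⇒x≈y (x*x≈0⇒x≈0 _≟_ (begin
        (x + y) * (x + y)  ≈⟨ square-+ x y ⟩
        x * x + y * y      ≈⟨ x≈y⇒x+y≈0 xx≈yy ⟩
        0#                 ∎))

  module CubicAutomorphism
    (_≟_ : Decidable _≈_) (1+1≈0 : 1# + 1# ≈ 0#)
    (σ : Carrier → Carrier) (σ-cong : Congruent _≈_ _≈_ σ)
    (σ-+ : ∀ x y → σ (x + y) ≈ σ x + σ y) (σ-* : ∀ x y → σ (x * y) ≈ σ x * σ y)
    (σ³ : ∀ x → σ (σ (σ x)) ≈ x)
    where

    open Characteristic2 1+1≈0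

    σ-0 : σ 0# ≈ 0#
    σ-0 = begin
      σ 0#          ≈⟨ σ-cong (+-identityʳ 0#) ⟨
      σ (0# + 0#)   ≈⟨ σ-+ 0# 0# ⟩
      σ 0# + σ 0#   ≈⟨ x+x≈0 (σ 0#) ⟩
      0#            ∎

    σ-1 : σ 1# ≈ 1#
    σ-1 = begin
      σ 1#                      ≈⟨ *-identityʳ (σ 1#) ⟨
      σ 1# * 1#                 ≈⟨ *-congˡ (σ³ 1#) ⟨
      σ 1# * σ (σ (σ 1#))       ≈⟨ σ-* 1# (σ (σ 1#)) ⟨
      σ (1# * σ (σ 1#))         ≈⟨ σ-cong (*-identityˡ (σ (σ 1#))) ⟩
      σ (σ (σ 1#))              ≈⟨ σ³ 1# ⟩
      1#                        ∎

    σx≈0⇒x≈0 : ∀ {x} → σ x ≈ 0# → x ≈ 0#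
    σx≈0⇒x≈0 {x} σx≈0 = begin
      x               ≈⟨ σ³ x ⟨
      σ (σ (σ x))     ≈⟨ σ-cong (σ-cong σx≈0) ⟩
      σ (σ 0#)        ≈⟨ σ-cong σ-0 ⟩
      σ 0#            ≈⟨ σ-0 ⟩
      0#              ∎

    ν : Carrier → Carrier
    ν x = x * σ x

    ν-cong : Congruent _≈_ _≈_ ν
    ν-cong x≈y = *-cong x≈y (σ-cong x≈y)

    ν-* : ∀ x y → ν (x * y) ≈ ν x * ν y
    ν-* x y = trans (*-congˡ (σ-* x y)) (interchange x y (σ x) (σ y))
      where
      interchange : ∀ x y u v → (x * y) * (u * v) ≈ (x * u) * (y * v)
      interchange = solve 4 (λ x y u v → (x :* y) :* (u :* v) := (x :* u) :* (y :* v)) refl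

    ν≈0⇒x≈0 : ∀ {x} → ν x ≈ 0# → x ≈ 0#
    ν≈0⇒x≈0 {x} νx≈0 with x ≟ 0#
    ... | yes x≈0 = x≈0
    ... | no  x≉0 = σx≈0⇒x≈0 (x*y≈0⇒y≈0 x≉0 νx≈0)

    -- t σt = 1 and σt σ²t = σ 1 = 1 make σ²t and t both inverse to σt, so t is σ-fixed and t² = 1.
    ν≈1⇒x≈1 : ∀ {t} → ν t ≈ 1# → t ≈ 1#
    ν≈1⇒x≈1 {t} νt≈1 = square-injective _≟_ (begin
      t * t      ≈⟨ *-congˡ σt≈t ⟨
      t * σ t    ≈⟨ νt≈1 ⟩
      1#         ≈⟨ *-identityʳ 1# ⟨
      1# * 1#    ∎)
      where
      νσt≈1 : σ t * σ (σ t) ≈ 1#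
      νσt≈1 = trans (sym (σ-* t (σ t))) (trans (σ-cong νt≈1) σ-1)
      rotate : ∀ x y z → z * (x * y) ≈ x * (y * z)
      rotate = solve 3 (λ x y z → z :* (x :* y) := x :* (y :* z)) refl
      σ²t≈t : σ (σ t) ≈ t
      σ²t≈t = begin
        σ (σ t)                  ≈⟨ *-identityʳ (σ (σ t)) ⟨
        σ (σ t) * 1#             ≈⟨ *-congˡ νt≈1 ⟨
        σ (σ t) * (t * σ t)      ≈⟨ rotate t (σ t) (σ (σ t)) ⟩
        t * (σ t * σ (σ t))      ≈⟨ *-congˡ νσt≈1 ⟩
        t * 1#                   ≈⟨ *-identityʳ t ⟩
        t                        ∎
      σt≈t : σ t ≈ t
      σt≈t = trans (σ-cong (sym σ²t≈t)) (σ³ t)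

    ν-injective : Injective _≈_ _≈_ ν
    ν-injective {x} {y} νx≈νy with y ≟ 0#
    ... | yes y≈0 = trans (ν≈0⇒x≈0 (trans νx≈νy (trans (*-congʳ y≈0) (zeroˡ (σ y))))) (sym y≈0)
    ... | no  y≉0 = begin
      x               ≈⟨ *-identityʳ x ⟨
      x * 1#          ≈⟨ *-congˡ yy⁻¹≈1 ⟨
      x * (y * y⁻¹)   ≈⟨ swap x y y⁻¹ ⟩
      (x * y⁻¹) * y   ≈⟨ *-congʳ (ν≈1⇒x≈1 ν[xy⁻¹]≈1) ⟩
      1# * y          ≈⟨ *-identityˡ y ⟩
      y               ∎
      where
      y⁻¹ : Carrier
      y⁻¹ = proj₁ (inverse y y≉0)
      yy⁻¹≈1 : y * y⁻¹ ≈ 1#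
      yy⁻¹≈1 = proj₂ (inverse y y≉0)
      swap : ∀ x y z → x * (y * z) ≈ (x * z) * y
      swap = solve 3 (λ x y z → x :* (y :* z) := (x :* z) :* y) refl
      ν[xy⁻¹]≈1 : ν (x * y⁻¹) ≈ 1#
      ν[xy⁻¹]≈1 = begin
        ν (x * y⁻¹)     ≈⟨ ν-* x y⁻¹ ⟩
        ν x * ν y⁻¹     ≈⟨ *-congʳ νx≈νy ⟩
        ν y * ν y⁻¹     ≈⟨ ν-* y y⁻¹ ⟨
        ν (y * y⁻¹)     ≈⟨ ν-cong yy⁻¹≈1 ⟩
        1# * σ 1#       ≈⟨ trans (*-identityˡ (σ 1#)) σ-1 ⟩
        1#              ∎

    -- The polynomial a X^(1+q) + b X^(1+q²) + X^(2q²+2q) of the theorem, with σ x standing for x ^ q.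
    f₂ : Carrier → Carrier → Carrier → Carrier
    f₂ a b x = (a * (x * σ x) + b * (x * σ (σ x))) + (σ (σ x) * σ (σ x)) * (σ x * σ x)

    module _ {a b : Carrier} where

      f₂-cong : Congruent _≈_ _≈_ (f₂ a b)
      f₂-cong {x} {y} x≈y = +-cong (+-cong (*-congˡ (ν-cong x≈y)) (*-congˡ (*-cong x≈y σ²x≈σ²y)))
                                   (*-cong (*-cong σ²x≈σ²y σ²x≈σ²y) (*-cong (σ-cong x≈y) (σ-cong x≈y)))
        where
        σ²x≈σ²y : σ (σ x) ≈ σ (σ y)
        σ²x≈σ²y = σ-cong (σ-cong x≈y)

      f₂-fixed : ∀ {r} → σ r ≈ r → f₂ a b r ≈ (a + b) * (r * r) + (r * r) * (r * r)
      f₂-fixed {r} σr≈r = begin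
        (a * (r * σ r) + b * (r * σ (σ r))) + (σ (σ r) * σ (σ r)) * (σ r * σ r)
          ≈⟨ +-cong (+-cong (*-congˡ (*-congˡ σr≈r)) (*-congˡ (*-congˡ σ²r≈r)))
                    (*-cong (*-cong σ²r≈r σ²r≈r) (*-cong σr≈r σr≈r)) ⟩
        (a * (r * r) + b * (r * r)) + (r * r) * (r * r)
          ≈⟨ +-congʳ (distribʳ (r * r) a b) ⟨
        (a + b) * (r * r) + (r * r) * (r * r) ∎
        where
        σ²r≈r : σ (σ r) ≈ r
        σ²r≈r = trans (σ-cong σr≈r) σr≈r

      f₂-0 : f₂ a b 0# ≈ 0#
      f₂-0 = begin
        f₂ a b 0#                                 ≈⟨ f₂-fixed σ-0 ⟩
        (a + b) * (0# * 0#) + (0# * 0#) * (0# * 0#)  ≈⟨ +-cong (*-congˡ 0²≈0) (*-cong 0²≈0 0²≈0) ⟩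
        (a + b) * 0# + 0# * 0#                    ≈⟨ +-cong (zeroʳ (a + b)) 0²≈0 ⟩
        0# + 0#                                   ≈⟨ +-identityʳ 0# ⟩
        0#                                        ∎
        where
        0²≈0 : 0# * 0# ≈ 0#
        0²≈0 = zeroˡ 0#

      -- If b ≠ a, a square root r of a + b lies in the fixed field of σ and is a nonzero root of f₂.
      injective⇒b≈a : (∀ s → ∃ λ r → r * r ≈ s) → σ a ≈ a → σ b ≈ b → Injective _≈_ _≈_ (f₂ a b) → b ≈ a
      injective⇒b≈a √ σa≈a σb≈b f₂-injective with (a + b) ≟ 0#
      ... | yes a+b≈0 = sym (x+y≈0⇒x≈y a+b≈0)
      ... | no  a+b≉0 = ⊥-elim (a+b≉0 (begin
        a + b     ≈⟨ rr≈a+b ⟨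
        r * r     ≈⟨ *-congʳ r≈0 ⟩
        0# * r    ≈⟨ zeroˡ r ⟩
        0#        ∎))
        where
        r : Carrier
        r = proj₁ (√ (a + b))
        rr≈a+b : r * r ≈ a + b
        rr≈a+b = proj₂ (√ (a + b))
        σr≈r : σ r ≈ r
        σr≈r = square-injective _≟_ (begin
          σ r * σ r     ≈⟨ σ-* r r ⟨
          σ (r * r)     ≈⟨ σ-cong rr≈a+b ⟩
          σ (a + b)     ≈⟨ trans (σ-+ a b) (+-cong σa≈a σb≈b) ⟩
          a + b         ≈⟨ rr≈a+b ⟨
          r * r         ∎)
        r≈0 : r ≈ 0#
        r≈0 = f₂-injective (begin
          f₂ a b r                                         ≈⟨ f₂-fixed σr≈r ⟩
          (a + b) * (r * r) + (r * r) * (r * r)            ≈⟨ +-cong (*-congˡ rr≈a+b) (*-cong rr≈a+b rr≈a+b) ⟩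
          (a + b) * (a + b) + (a + b) * (a + b)            ≈⟨ x+x≈0 _ ⟩
          0#                                               ≈⟨ f₂-0 ⟨
          f₂ a b 0#                                        ∎)

    module _ (a : Carrier) (σa≈a : σ a ≈ a) (a≉0 : ¬ a ≈ 0#) where

      L : Carrier → Carrier
      L y = (a * y + a * σ (σ y)) + σ y * σ y

      L-+ : ∀ y z → L (y + z) ≈ L y + L z
      L-+ y z = begin
        (a * (y + z) + a * σ (σ (y + z))) + σ (y + z) * σ (y + z)
          ≈⟨ +-cong (+-congˡ (*-congˡ σ²-+)) (*-cong (σ-+ y z) (σ-+ y z)) ⟩
        (a * (y + z) + a * (σ (σ y) + σ (σ z))) + (σ y + σ z) * (σ y + σ z)
          ≈⟨ +-congˡ (square-+ (σ y) (σ z)) ⟩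
        (a * (y + z) + a * (σ (σ y) + σ (σ z))) + (σ y * σ y + σ z * σ z)
          ≈⟨ regroup a y z (σ y) (σ z) (σ (σ y)) (σ (σ z)) ⟩
        L y + L z ∎
        where
        σ²-+ : σ (σ (y + z)) ≈ σ (σ y) + σ (σ z)
        σ²-+ = trans (σ-cong (σ-+ y z)) (σ-+ (σ y) (σ z))
        regroup : ∀ a y z u v U V → (a * (y + z) + a * (U + V)) + (u * u + v * v)
                                  ≈ ((a * y + a * U) + u * u) + ((a * z + a * V) + v * v)
        regroup = solve 7 (λ a y z u v U V → (a :* (y :+ z) :+ a :* (U :+ V)) :+ (u :* u :+ v :* v)
                                          := ((a :* y :+ a :* U) :+ u :* u) :+ ((a :* z :+ a :* V) :+ v :* v)) refl

      σ-L : ∀ y → σ (L y) ≈ L (σ y)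
      σ-L y = begin
        σ ((a * y + a * σ (σ y)) + σ y * σ y)
          ≈⟨ trans (σ-+ _ _) (+-cong (σ-+ _ _) (σ-* _ _)) ⟩
        (σ (a * y) + σ (a * σ (σ y))) + σ (σ y) * σ (σ y)
          ≈⟨ +-congʳ (+-cong (trans (σ-* a y) (*-congʳ σa≈a)) (trans (σ-* a _) (*-congʳ σa≈a))) ⟩
        L (σ y) ∎

      Tr : Carrier → Carrier
      Tr w = (w + σ w) + σ (σ w)

      L-trace : ∀ w → (L w + L (σ w)) + L (σ (σ w)) ≈ Tr w * Tr w
      L-trace w = begin
        (L w + L (σ w)) + L (σ (σ w))
          ≈⟨ +-cong (+-congˡ (+-congʳ (+-congˡ (*-congˡ (σ³ w))))) L[σ²w] ⟩
        (((a * w + a * w₂) + w₁ * w₁) + ((a * w₁ + a * w) + w₂ * w₂)) + ((a * w₂ + a * w₁) + w * w)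
          ≈⟨ regroup a w w₁ w₂ ⟩
        ((w * w + w₁ * w₁) + w₂ * w₂) + (aTr + aTr)
          ≈⟨ +-congˡ (x+x≈0 aTr) ⟩
        ((w * w + w₁ * w₁) + w₂ * w₂) + 0#
          ≈⟨ +-identityʳ _ ⟩
        (w * w + w₁ * w₁) + w₂ * w₂
          ≈⟨ +-congʳ (square-+ w w₁) ⟨
        (w + w₁) * (w + w₁) + w₂ * w₂
          ≈⟨ square-+ (w + w₁) w₂ ⟨
        Tr w * Tr w ∎
        where
        w₁ w₂ aTr : Carrier
        w₁ = σ w
        w₂ = σ w₁
        aTr = (a * w + a * w₁) + a * w₂
        L[σ²w] : L w₂ ≈ (a * w₂ + a * w₁) + w * w
        L[σ²w] = +-cong (+-congˡ (*-congˡ (σ-cong (σ³ w)))) (*-cong (σ³ w) (σ³ w))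
        regroup : ∀ a w w₁ w₂ → (((a * w + a * w₂) + w₁ * w₁) + ((a * w₁ + a * w) + w₂ * w₂)) + ((a * w₂ + a * w₁) + w * w)
                              ≈ ((w * w + w₁ * w₁) + w₂ * w₂) + (((a * w + a * w₁) + a * w₂) + ((a * w + a * w₁) + a * w₂))
        regroup = solve 4 (λ a w w₁ w₂ →
          (((a :* w :+ a :* w₂) :+ w₁ :* w₁) :+ ((a :* w₁ :+ a :* w) :+ w₂ :* w₂)) :+ ((a :* w₂ :+ a :* w₁) :+ w :* w)
          := ((w :* w :+ w₁ :* w₁) :+ w₂ :* w₂) :+ (((a :* w :+ a :* w₁) :+ a :* w₂) :+ ((a :* w :+ a :* w₁) :+ a :* w₂))) refl

      L≈0⇒Tr≈0 : ∀ {w} → L w ≈ 0# → Tr w ≈ 0#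
      L≈0⇒Tr≈0 {w} Lw≈0 = x*x≈0⇒x≈0 _≟_ (begin
        Tr w * Tr w                      ≈⟨ L-trace w ⟨
        (L w + L (σ w)) + L (σ (σ w))    ≈⟨ +-cong (+-cong Lw≈0 L[σw]≈0) L[σ²w]≈0 ⟩
        (0# + 0#) + 0#                   ≈⟨ trans (+-identityʳ _) (+-identityʳ 0#) ⟩
        0#                               ∎)
        where
        L[σw]≈0 : L (σ w) ≈ 0#
        L[σw]≈0 = trans (sym (σ-L w)) (trans (σ-cong Lw≈0) σ-0)
        L[σ²w]≈0 : L (σ (σ w)) ≈ 0#
        L[σ²w]≈0 = trans (sym (σ-L (σ w))) (trans (σ-cong L[σw]≈0) σ-0)

      -- Substituting σ w = w + σ² w (i.e. Tr w = 0) into L w = 0 gives σ w (a + σ w) = 0.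
      L≈0⇒σw≈a : ∀ {w} → ¬ w ≈ 0# → L w ≈ 0# → σ w ≈ a
      L≈0⇒σw≈a {w} w≉0 Lw≈0 = sym (x+y≈0⇒x≈y (x*y≈0⇒y≈0 (w≉0 ∘ σx≈0⇒x≈0) (begin
        σ w * (a + σ w)                      ≈⟨ expand a (σ w) ⟩
        a * σ w + σ w * σ w                  ≈⟨ +-congʳ (*-congˡ σw≈w+σ²w) ⟩
        a * (w + σ (σ w)) + σ w * σ w        ≈⟨ +-congʳ (distribˡ a w (σ (σ w))) ⟩
        L w                                  ≈⟨ Lw≈0 ⟩
        0#                                   ∎)))
        where
        expand : ∀ a u → u * (a + u) ≈ a * u + u * u
        expand = solve 2 (λ a u → u :* (a :+ u) := a :* u :+ u :* u) refl
        rearrange : ∀ x y z → y + (x + z) ≈ (x + y) + z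
        rearrange = solve 3 (λ x y z → y :+ (x :+ z) := (x :+ y) :+ z) refl
        σw≈w+σ²w : σ w ≈ w + σ (σ w)
        σw≈w+σ²w = x+y≈0⇒x≈y (trans (rearrange w (σ w) (σ (σ w))) (L≈0⇒Tr≈0 Lw≈0))

      L-kernel : ∀ {w} → L w ≈ 0# → w ≈ 0#
      L-kernel {w} Lw≈0 with w ≟ 0#
      ... | yes w≈0 = w≈0
      ... | no  w≉0 = ⊥-elim (a≉0 (begin
        a                          ≈⟨ +-identityˡ a ⟨
        0# + a                     ≈⟨ +-congʳ (x+x≈0 a) ⟨
        (a + a) + a                ≈⟨ +-cong (+-cong w≈a σw≈a) σ²w≈a ⟨
        Tr w                       ≈⟨ L≈0⇒Tr≈0 Lw≈0 ⟩
        0#                         ∎))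
        where
        σw≈a : σ w ≈ a
        σw≈a = L≈0⇒σw≈a w≉0 Lw≈0
        σ²w≈a : σ (σ w) ≈ a
        σ²w≈a = trans (σ-cong σw≈a) σa≈a
        w≈a : w ≈ a
        w≈a = trans (sym (σ³ w)) (trans (σ-cong σ²w≈a) σa≈a)

      L-injective : Injective _≈_ _≈_ L
      L-injective {y} {z} Ly≈Lz = x+y≈0⇒x≈y (L-kernel (trans (L-+ y z) (x≈y⇒x+y≈0 Ly≈Lz)))

      f₂≈L∘ν : ∀ {b} → b ≈ a → ∀ x → f₂ a b x ≈ L (ν x)
      f₂≈L∘ν {b} b≈a x = begin
        (a * (x * x₁) + b * (x * x₂)) + (x₂ * x₂) * (x₁ * x₁)   ≈⟨ +-congʳ (+-congˡ (*-congʳ b≈a)) ⟩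
        (a * (x * x₁) + a * (x * x₂)) + (x₂ * x₂) * (x₁ * x₁)   ≈⟨ regroup a x x₁ x₂ ⟩
        (a * (x * x₁) + a * (x₂ * x)) + (x₁ * x₂) * (x₁ * x₂)   ≈⟨ +-cong (+-congˡ (*-congˡ σ²[νx])) (*-cong σ[νx] σ[νx]) ⟨
        L (ν x)                                                  ∎
        where
        x₁ x₂ : Carrier
        x₁ = σ x
        x₂ = σ x₁
        σ[νx] : σ (ν x) ≈ x₁ * x₂
        σ[νx] = σ-* x x₁
        σ²[νx] : σ (σ (ν x)) ≈ x₂ * x
        σ²[νx] = trans (σ-cong σ[νx]) (trans (σ-* x₁ x₂) (*-congˡ (σ³ x)))
        regroup : ∀ a x u v → (a * (x * u) + a * (x * v)) + (v * v) * (u * u)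
                            ≈ (a * (x * u) + a * (v * x)) + (u * v) * (u * v)
        regroup = solve 4 (λ a x u v → (a :* (x :* u) :+ a :* (x :* v)) :+ (v :* v) :* (u :* u)
                                    := (a :* (x :* u) :+ a :* (v :* x)) :+ (u :* v) :* (u :* v)) refl

      f₂-injective : ∀ {b} → b ≈ a → Injective _≈_ _≈_ (f₂ a b)
      f₂-injective b≈a {x} {y} f₂x≈f₂y =
        ν-injective (L-injective (trans (sym (f₂≈L∘ν b≈a x)) (trans f₂x≈f₂y (f₂≈L∘ν b≈a y))))

  module FieldOfOrderQ³ (m : ℕ) (card : HasCard F ((2 N.^ suc m) N.^ 3)) where

    q : ℕ
    q = 2 N.^ suc m

    open FiniteField card public using (_≟_; injective⇒surjective)

    1+1≈0 : 1# + 1# ≈ 0#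
    1+1≈0 = even-cardinality⇒1+1≈0 card (∣-trans (m∣m*n (2 N.^ m)) (m∣m*n (q N.^ 2)))

    open Characteristic2 1+1≈0 using (freshmans-dream; square-injective)

    x^q³≈x : ∀ x → ((x ^ q) ^ q) ^ q ≈ x
    x^q³≈x x = begin
      ((x ^ q) ^ q) ^ q       ≈⟨ ^-congˡ q (^-assocʳ x q q) ⟩
      (x ^ (q N.* q)) ^ q     ≈⟨ ^-assocʳ x (q N.* q) q ⟩
      x ^ (q N.* q N.* q)     ≡⟨ ≡.cong (x ^_) q*q*q≡q³ ⟩
      x ^ (q N.^ 3)           ≈⟨ x^card≈x card x ⟩
      x                       ∎
      where
      q*q*q≡q³ : q N.* q N.* q ≡ q N.^ 3
      q*q*q≡q³ = ≡.trans (NP.*-assoc q q q) (≡.cong (λ k → q N.* (q N.* k)) (≡.sym (NP.*-identityʳ q)))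

    open CubicAutomorphism _≟_ 1+1≈0 (_^ q) (^-congˡ q) (freshmans-dream (suc m)) (λ x y → ^-distrib-* x y q) x^q³≈x
      public using (f₂; f₂-cong; f₂-injective; injective⇒b≈a)

    squareRoot : ∀ s → ∃ λ r → r * r ≈ s
    squareRoot s = let r , rr≈s = squaring-surjective s in r , rr≈s refl
      where
      squaring-surjective : Surjective _≈_ _≈_ (λ r → r * r)
      squaring-surjective = injective⇒surjective (λ r≈r′ → *-cong r≈r′ r≈r′) (square-injective _≟_)

    f : Carrier → Carrier → Carrier → Carrier
    f a b x = ((a * pow F x (1 N.+ q)) + (b * pow F x (1 N.+ q N.^ 2))) + pow F x ((2 N.* q N.^ 2) N.+ (2 N.* q))

    f≈f₂ : ∀ a b x → f a b x ≈ f₂ a b x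
    f≈f₂ a b x rewrite pow≡^ x (1 N.+ q) | pow≡^ x (1 N.+ q N.^ 2) | pow≡^ x ((2 N.* q N.^ 2) N.+ (2 N.* q)) =
      +-cong (+-congˡ (*-congˡ (*-congˡ x^q²≈σ²x))) (begin
        x ^ (2 N.* q N.^ 2 N.+ 2 N.* q)                    ≈⟨ ^-homo-* x (2 N.* q N.^ 2) (2 N.* q) ⟩
        x ^ (2 N.* q N.^ 2) * x ^ (2 N.* q)                ≈⟨ *-cong (^-double x (q N.^ 2)) (^-double x q) ⟩
        (x ^ (q N.^ 2) * x ^ (q N.^ 2)) * (x ^ q * x ^ q)  ≈⟨ *-congʳ (*-cong x^q²≈σ²x x^q²≈σ²x) ⟩
        ((x ^ q) ^ q * (x ^ q) ^ q) * (x ^ q * x ^ q)      ∎)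
      where
      x^q²≈σ²x : x ^ (q N.^ 2) ≈ (x ^ q) ^ q
      x^q²≈σ²x = trans (sym (^-assocʳ x q (q N.* 1))) (^-congʳ (x ^ q) (NP.*-identityʳ q))

    f-cong : ∀ {a b} → Congruent _≈_ _≈_ (f a b)
    f-cong {a} {b} {x} {y} x≈y = trans (f≈f₂ a b x) (trans (f₂-cong x≈y) (sym (f≈f₂ a b y)))

    InSubfield⇒x^q≈x : ∀ {a} → InSubfield F q a → a ^ q ≈ a
    InSubfield⇒x^q≈x {a} a∈F_q = trans (reflexive (≡.sym (pow≡^ a q))) a∈F_q

theorem3p2 : ∀ {c ℓ : Level} (m : ℕ) → 1 N.≤ m → let q = 2 N.^ m in
    (F : Field c ℓ) → HasCard F (q N.^ 3) →
    let open Field F in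
    (a b : Carrier) →
    InSubfield F q a → ¬ (a ≈ 0#) →
    InSubfield F q b → ¬ (b ≈ 0#) →
    (IsPermutation F
      (λ x → ((a * pow F x (1 N.+ q)) + (b * pow F x (1 N.+ q N.^ 2))) + pow F x ((2 N.* q N.^ 2) N.+ (2 N.* q)))
     ⇔ (b ≈ a))
theorem3p2 zero ()
theorem3p2 (suc m) _ F card a b a∈F_q a≉0 b∈F_q _ = mk⇔ bijective⇒b≈a b≈a⇒bijective
  where
  open Field F
  open FieldOfOrderQ³ F m card

  bijective⇒b≈a : IsPermutation F (f a b) → b ≈ a
  bijective⇒b≈a (f-injective , _) = injective⇒b≈a squareRoot (InSubfield⇒x^q≈x a∈F_q) (InSubfield⇒x^q≈x b∈F_q)
    (injective-resp-≈ F (f≈f₂ a b) f-injective)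

  b≈a⇒bijective : b ≈ a → IsPermutation F (f a b)
  b≈a⇒bijective b≈a = f-injective , injective⇒surjective f-cong f-injective
    where
    f-injective : Injective _≈_ _≈_ (f a b)
    f-injective = injective-resp-≈ F (λ x → sym (f≈f₂ a b x)) (f₂-injective a (InSubfield⇒x^q≈x a∈F_q) a≉0 b≈a)
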